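{- Let $G=K_{n,n}$ be the balanced complete bipartite graph on $2n$ vertices. Then $\varphi(G^2)=(n-1)(2n-1)$.
   Context: All graphs are simple and finite. $\mathbb{N}_0$ denotes the set of non-negative integers. For non-empty $A,B\subseteq\mathbb{N}_0$, $A+B=\{a+b: a\in A, b\in B\}$. An integer additive set-indexer (IASI) of a graph $G$ is an injective function $f:V(G)\to\mathcal{P}(\mathbb{N}_0)$ with non-empty values such that the induced map $f^+(uv)=f(u)+f(v)$ on $E(G)$ is also injective. An IASI is weak if $|f^+(uv)|=\max(|f(u)|,|f(v)|)$ for every edge $uv$. An element (vertex or edge) is mono-indexed if its set-label has cardinality $1$. The sparing number $\varphi(H)$ of a graph $H$ is the minimum number of mono-indexed edges over all weak IASIs of $H$. The square $G^2$ of $G$ has vertex set $V(G)$, two distinct vertices adjacent iff their distance in $G$ is at most $2$. -}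

module Defs where

open import Data.Bool using (Bool; true; false; _∧_; _∨_; not; _xor_; if_then_else_)
open import Data.Bool.Properties using (∧-comm; ∨-comm)
open import Data.Nat using (ℕ; _+_; _≤_; _<_; _⊔_; _<ᵇ_; _≡ᵇ_)
open import Data.Nat.Properties using (_≟_)
open import Data.Fin using (Fin; toℕ)
open import Data.Fin.Properties using () renaming (_≟_ to _≟ᶠ_)
open import Data.List using (List; []; _∷_; map; length; concatMap; deduplicate; allFin)
open import Data.Bool.ListAction using (any; or)
open import Data.Nat.ListAction using (sum)
open import Data.List.Properties using (map-cong)
open import Data.List.Membership.Propositional using (_∈_)
open import Data.List.Relation.Unary.Unique.Propositional using (Unique)
open import Data.Product using (Σ; _×_; _,_)
open import Relation.Nullary using (¬_; does)
open import Relation.Binary.PropositionalEquality using (_≡_; _≢_; refl; cong; cong₂; sym; trans)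

record Graph : Set where
  field
    order  : ℕ
    adj    : Fin order → Fin order → Bool
    adj-sym    : ∀ u v → adj u v ≡ adj v u
    adj-irrefl : ∀ u → adj u u ≡ false
open Graph public

-- Balanced complete bipartite graph K_{n,n}: vertices 0..n-1 form one
-- part, n..2n-1 the other; two vertices are adjacent iff in different parts.
side : (n : ℕ) → Fin (n + n) → Bool
side n v = toℕ v <ᵇ n

xor-self : ∀ b → b xor b ≡ false
xor-self true = refl
xor-self false = refl

xor-comm : ∀ a b → a xor b ≡ b xor a
xor-comm true true = refl
xor-comm true false = refl
xor-comm false true = refl
xor-comm false false = refl

K : ℕ → Graph
K n = record
  { order  = n + n
  ; adj    = λ u v → side n u xor side n v
  ; adj-sym    = λ u v → xor-comm (side n u) (side n v)
  ; adj-irrefl = λ u → xor-self (side n u)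
  }

_≠ᵇ_ : ∀ {m} → Fin m → Fin m → Bool
u ≠ᵇ v = not (does (u ≟ᶠ v))

≠ᵇ-sym : ∀ {m} (u v : Fin m) → u ≠ᵇ v ≡ v ≠ᵇ u
≠ᵇ-sym u v with u ≟ᶠ v | v ≟ᶠ u
... | Relation.Nullary.yes _ | Relation.Nullary.yes _ = refl
... | Relation.Nullary.no _  | Relation.Nullary.no _  = refl
... | Relation.Nullary.yes p | Relation.Nullary.no q  = Data.Empty.⊥-elim (q (sym p))
  where import Data.Empty
... | Relation.Nullary.no q  | Relation.Nullary.yes p = Data.Empty.⊥-elim (q (sym p))
  where import Data.Empty

≠ᵇ-refl : ∀ {m} (u : Fin m) → u ≠ᵇ u ≡ false
≠ᵇ-refl u with u ≟ᶠ u
... | Relation.Nullary.yes _ = refl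
... | Relation.Nullary.no q  = Data.Empty.⊥-elim (q refl)
  where import Data.Empty

adj² : (G : Graph) → Fin (order G) → Fin (order G) → Bool
adj² G u v = (u ≠ᵇ v) ∧ (adj G u v ∨ any (λ w → adj G u w ∧ adj G w v) (allFin (order G)))

adj²-sym : (G : Graph) → ∀ u v → adj² G u v ≡ adj² G v u
adj²-sym G u v = cong₂ _∧_ (≠ᵇ-sym u v)
  (cong₂ _∨_ (Graph.adj-sym G u v)
     (cong or (map-cong (λ w → trans (∧-comm (adj G u w) (adj G w v))
                                          (cong₂ _∧_ (Graph.adj-sym G w v) (Graph.adj-sym G u w)))
                                  (allFin (order G)))))

square : Graph → Graph
square G = record
  { order  = order G
  ; adj    = adj² G
  ; adj-sym    = adj²-sym G
  ; adj-irrefl = λ u → cong (λ b → b ∧ (adj G u u ∨ any (λ w → adj G u w ∧ adj G w u) (allFin (order G)))) (≠ᵇ-refl u)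
  }

-- Finite subsets of ℕ₀, represented by duplicate-free lists.

_≋_ : List ℕ → List ℕ → Set
A ≋ B = ∀ x → (x ∈ A → x ∈ B) × (x ∈ B → x ∈ A)

_⊕_ : List ℕ → List ℕ → List ℕ
A ⊕ B = deduplicate _≟_ (concatMap (λ a → map (a +_) B) A)

-- Edges: each edge {u,v} is represented once, as the pair with u < v.

Edge : (G : Graph) → Fin (order G) → Fin (order G) → Set
Edge G u v = (toℕ u < toℕ v) × (adj G u v ≡ true)

isEdge : (G : Graph) → Fin (order G) → Fin (order G) → Bool
isEdge G u v = (toℕ u <ᵇ toℕ v) ∧ adj G u v

record WeakIASI (G : Graph) : Set where
  field
    f        : Fin (order G) → List ℕ
    unique   : ∀ v → Unique (f v)
    nonempty : ∀ v → f v ≢ []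
    inj      : ∀ u v → f u ≋ f v → u ≡ v
    edgeInj  : ∀ u v u′ v′ → Edge G u v → Edge G u′ v′ →
               (f u ⊕ f v) ≋ (f u′ ⊕ f v′) → (u ≡ u′) × (v ≡ v′)
    weak     : ∀ u v → Edge G u v →
               length (f u ⊕ f v) ≡ length (f u) ⊔ length (f v)
open WeakIASI public

monoCount : (G : Graph) → WeakIASI G → ℕ
monoCount G w =
  sum (map (λ u → sum (map (λ v →
         if isEdge G u v ∧ (length (f w u ⊕ f w v) ≡ᵇ 1) then 1 else 0)
       (allFin (order G))))
     (allFin (order G)))

IsSparingNumber : Graph → ℕ → Set
IsSparingNumber G k =
  (Σ (WeakIASI G) λ w → monoCount G w ≡ k) × (∀ (w : WeakIASI G) → k ≤ monoCount G w)

module Submission where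

-- Any two vertices of K_{n,n} are at distance at most 2, so its square is
-- the complete graph on N = 2n vertices, and the corollary is an instance
-- of φ(K_N) = C(N-1, 2), which is proved here for every complete
-- graph.
--
-- Lower bound.  If |A|, |B| >= 2 then |A + B| > max(|A|, |B|): for
-- b1 < b2 in B, the sums a + b1 (a in A) and max A + b2 are |A| + 1
-- distinct elements of A + B.  Hence every edge of a weak IASI has a
-- mono-indexed end, so in a complete graph at most one vertex is not
-- mono-indexed, and at least C(N-1, 2) edges join two mono-indexed vertices.
-- For a complete graph an edge is mono-indexed exactly when both ends are,
-- so the mono-indexed edges are counted by the pairs u < v of mono-indexed
-- vertices.
--
-- Upper bound.  Label vertex 0 by {0, 1} and vertex i + 1 by {2^i}.  Sums of
-- two distinct powers of two determine the exponents, which makes this a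
-- weak IASI of any graph; its mono-indexed edges are exactly those avoiding
-- vertex 0, i.e. C(N-1, 2) of them in a complete graph.

open import Defs
open import Data.Bool using (Bool; true; false; _∧_; _∨_; _xor_; T; if_then_else_)
open import Data.Bool.ListAction using (any)
open import Data.Bool.Properties using (T-≡)
open import Data.Fin using (Fin; zero; suc; toℕ; fromℕ<)
import Data.Fin.Properties as Fin
open import Data.List using (List; []; _∷_; map; length; filter; tabulate; allFin)
open import Data.List.Extrema.Nat using (max; xs≤max; v≤max⁺; argmax-sel)
open import Data.List.Membership.Propositional using (_∈_; find)
open import Data.List.Membership.Propositional.Properties
  using (∈-map⁺; ∈-map⁻; ∈-concatMap⁺; ∈-concatMap⁻; ∈-deduplicate⁺; ∈-deduplicate⁻; ∈-filter⁺; ∈-allFin)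
open import Data.List.Properties using (filter-notAll; filter-accept; length-map; map-tabulate)
open import Data.List.Relation.Binary.Subset.Propositional using (_⊆_)
import Data.List.Relation.Unary.All as All
open import Data.List.Relation.Unary.All using ([]; _∷_)
open import Data.List.Relation.Unary.AllPairs using ([]; _∷_)
import Data.List.Relation.Unary.Any as Any
open import Data.List.Relation.Unary.Any using (here; there)
open import Data.List.Relation.Unary.Any.Properties using (any⁺)
open import Data.List.Relation.Unary.Unique.Propositional using (Unique)
import Data.List.Relation.Unary.Unique.Propositional.Properties as Unique
open import Data.Nat
open import Data.Nat.ListAction using (sum)
open import Data.Nat.Properties
open import Data.Nat.Tactic.RingSolver using (solve-∀)
open import Data.List.Relation.Unary.Unique.DecPropositional.Properties _≟_ using (deduplicate-!)
open import Data.Product using (∃₂; _×_; _,_; proj₁; proj₂)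
import Data.Product
open import Data.Sum using (_⊎_; inj₁; inj₂)
import Data.Sum
open import Function using (_∘_; Equivalence)
open import Relation.Binary.Definitions using (tri<; tri≈; tri>)
open import Relation.Binary.PropositionalEquality
open import Relation.Nullary using (¬?; yes; no; contradiction)

-- Pigeonhole for lists: a duplicate-free list is no longer than any list
-- containing all of its elements.  (Delete the head from the larger list
-- and recurse.)
unique-length-≤ : ∀ {L M : List ℕ} → Unique L → L ⊆ M → length L ≤ length M
unique-length-≤ {[]} _ _ = z≤n
unique-length-≤ {x ∷ L} {M} (x∉L ∷ uL) L⊆M = begin-strict
  length L          ≤⟨ unique-length-≤ uL L⊆M-x ⟩
  length (M - x)    <⟨ filter-notAll (¬? ∘ (x ≟_)) M (Any.map (λ x≡y x≢y → x≢y x≡y) (L⊆M (here refl))) ⟩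
  length M          ∎
  where
  open ≤-Reasoning
  _-_ : List ℕ → ℕ → List ℕ
  M - x = filter (¬? ∘ (x ≟_)) M
  L⊆M-x : L ⊆ M - x
  L⊆M-x y∈L = ∈-filter⁺ (¬? ∘ (x ≟_)) (L⊆M (there y∈L)) (All.lookup x∉L y∈L)

≋⇒length≡ : ∀ {A B} → Unique A → Unique B → A ≋ B → length A ≡ length B
≋⇒length≡ uA uB A≋B =
  ≤-antisym (unique-length-≤ uA (λ {x} → proj₁ (A≋B x))) (unique-length-≤ uB (λ {x} → proj₂ (A≋B x)))

⊕-intro : ∀ {A B a b} → a ∈ A → b ∈ B → a + b ∈ A ⊕ B
⊕-intro {B = B} {b = b} a∈A b∈B =
  ∈-deduplicate⁺ _≟_ (∈-concatMap⁺ (λ a → map (a +_) B) (Any.map (λ { refl → ∈-map⁺ (_ +_) b∈B }) a∈A))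

⊕-elim : ∀ {A B x} → x ∈ A ⊕ B → ∃₂ λ a b → a ∈ A × b ∈ B × x ≡ a + b
⊕-elim {A} {B} x∈ with a , a∈A , x∈a+B ← find (∈-concatMap⁻ (λ a → map (a +_) B) (∈-deduplicate⁻ _≟_ _ x∈))
                     with b , b∈B , x≡a+b ← ∈-map⁻ (a +_) x∈a+B
  = a , b , a∈A , b∈B , x≡a+b

⊕-unique : ∀ A B → Unique (A ⊕ B)
⊕-unique A B = deduplicate-! _

length-⊕-comm : ∀ A B → length (A ⊕ B) ≡ length (B ⊕ A)
length-⊕-comm A B = ≋⇒length≡ (⊕-unique A B) (⊕-unique B A) λ _ → swap-⊕ A B , swap-⊕ B A
  where
  swap-⊕ : ∀ A B {x} → x ∈ A ⊕ B → x ∈ B ⊕ A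
  swap-⊕ A B x∈ with a , b , a∈A , b∈B , refl ← ⊕-elim {A} {B} x∈ = subst (_∈ B ⊕ A) (+-comm b a) (⊕-intro {B} {A} b∈B a∈A)

-- Adding a set B with two elements b₁ < b₂ strictly enlarges A: the shifts
-- a + b₁ (a ∈ A) are distinct, and max A + b₂ exceeds all of them.
sumset-grows : ∀ {a A B b₁ b₂} → Unique (a ∷ A) → b₁ ∈ B → b₂ ∈ B → b₁ < b₂ →
               length (a ∷ A) < length ((a ∷ A) ⊕ B)
sumset-grows {a} {A} {B} {b₁} {b₂} uA b₁∈B b₂∈B b₁<b₂ = begin-strict
  length (a ∷ A)                 ≡⟨ length-map (_+ b₁) (a ∷ A) ⟨
  length shifted                 <⟨ unique-length-≤ (All.tabulate top-fresh ∷ shifted-unique) sums⊆ ⟩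
  length ((a ∷ A) ⊕ B)           ∎
  where
  open ≤-Reasoning
  m : ℕ
  m = max a A
  m∈ : m ∈ a ∷ A
  m∈ with argmax-sel (λ x → x) a A
  ... | inj₁ m≡a = here m≡a
  ... | inj₂ m∈A = there m∈A
  ≤m : ∀ {x} → x ∈ a ∷ A → x ≤ m
  ≤m (here refl) = v≤max⁺ a A (inj₁ ≤-refl)
  ≤m (there x∈A) = All.lookup (xs≤max a A) x∈A
  shifted : List ℕ
  shifted = map (_+ b₁) (a ∷ A)
  shifted-unique : Unique shifted
  shifted-unique = Unique.map⁺ (λ {x} {y} → +-cancelʳ-≡ b₁ x y) uA
  top-fresh : ∀ {y} → y ∈ shifted → m + b₂ ≢ y
  top-fresh y∈ with x , x∈ , refl ← ∈-map⁻ (_+ b₁) y∈ = >⇒≢ (+-mono-≤-< (≤m x∈) b₁<b₂)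
  sums⊆ : m + b₂ ∷ shifted ⊆ (a ∷ A) ⊕ B
  sums⊆ (here refl) = ⊕-intro m∈ b₂∈B
  sums⊆ (there y∈) with x , x∈ , refl ← ∈-map⁻ (_+ b₁) y∈ = ⊕-intro x∈ b₁∈B

ordered-pair : ∀ {B} → Unique B → 2 ≤ length B → ∃₂ λ b₁ b₂ → b₁ ∈ B × b₂ ∈ B × b₁ < b₂
ordered-pair {[]} _ ()
ordered-pair {_ ∷ []} _ (s≤s ())
ordered-pair {x ∷ y ∷ _} ((x≢y ∷ _) ∷ _) _ with <-cmp x y
... | tri< x<y _ _ = x , y , here refl , there (here refl) , x<y
... | tri≈ _ x≡y _ = contradiction x≡y x≢y
... | tri> _ _ y<x = y , x , there (here refl) , here refl , y<x

-- If |A|, |B| ≥ 2 then |A ⊕ B| > max(|A|, |B|): a weak sum needs a singleton.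
sumset-exceeds-max : ∀ {A B} → Unique A → Unique B → 2 ≤ length A → 2 ≤ length B →
                     length A ⊔ length B < length (A ⊕ B)
sumset-exceeds-max {A@(_ ∷ _)} {B@(_ ∷ _)} uA uB 2≤|A| 2≤|B|
  with b₁ , b₂ , b₁∈B , b₂∈B , b₁<b₂ ← ordered-pair uB 2≤|B|
     | a₁ , a₂ , a₁∈A , a₂∈A , a₁<a₂ ← ordered-pair uA 2≤|A|
  = ⊔-lub (sumset-grows uA b₁∈B b₂∈B b₁<b₂)
          (subst (length B <_) (length-⊕-comm B A) (sumset-grows uB a₁∈A a₂∈A a₁<a₂))

ΣF : ∀ N → (Fin N → ℕ) → ℕ
ΣF N g = sum (tabulate g)

ΣF-cong : ∀ N {g h : Fin N → ℕ} → (∀ i → g i ≡ h i) → ΣF N g ≡ ΣF N h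
ΣF-cong zero    g≗h = refl
ΣF-cong (suc N) g≗h = cong₂ _+_ (g≗h zero) (ΣF-cong N (g≗h ∘ suc))

sum-allFin : ∀ N (g : Fin N → ℕ) → sum (map g (allFin N)) ≡ ΣF N g
sum-allFin N g = cong sum (map-tabulate (λ i → i) g)

Ind : Bool → ℕ
Ind b = if b then 1 else 0

count : ∀ N → (Fin N → Bool) → ℕ
count N b = ΣF N (Ind ∘ b)

count-all : ∀ N {b : Fin N → Bool} → (∀ i → b i ≡ true) → count N b ≡ N
count-all zero    _   = refl
count-all (suc N) all rewrite all zero = cong suc (count-all N (all ∘ suc))

count-none : ∀ N {b : Fin N → Bool} → (∀ i → b i ≡ false) → count N b ≡ 0
count-none zero    _    = refl
count-none (suc N) none rewrite none zero = count-none N (none ∘ suc)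

-- b fails at most once; the mono-indexed vertices of a weak IASI of a
-- complete graph have this property (complete-amo below)
AtMostOneFalse : ∀ {N} → (Fin N → Bool) → Set
AtMostOneFalse {N} b = ∀ (i j : Fin N) → i ≢ j → b i ≡ true ⊎ b j ≡ true

amo-tail : ∀ {N} {b : Fin (suc N) → Bool} → AtMostOneFalse b → AtMostOneFalse (b ∘ suc)
amo-tail amo i j i≢j = amo (suc i) (suc j) (i≢j ∘ Fin.suc-injective)

amo-head-false : ∀ {N} {b : Fin (suc N) → Bool} → AtMostOneFalse b → b zero ≡ false → ∀ i → b (suc i) ≡ true
amo-head-false amo b₀≡false i with amo zero (suc i) (λ ())
... | inj₁ b₀≡true = contradiction (trans (sym b₀≡false) b₀≡true) (λ ())
... | inj₂ bᵢ≡true = bᵢ≡true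

count-amo : ∀ N {b : Fin N → Bool} → AtMostOneFalse b → N ∸ 1 ≤ count N b
count-amo zero    _ = z≤n
count-amo (suc N) {b} amo with b zero in b₀
... | true  = ≤-trans (m≤n+m∸n N 1) (s≤s (count-amo N (amo-tail amo)))
... | false = ≤-reflexive (sym (count-all N (amo-head-false amo b₀)))

-- tri k = k(k-1)/2, the number of pairs i < j below k
tri : ℕ → ℕ
tri zero    = 0
tri (suc k) = k + tri k

tri-pred : ∀ k → tri k ≡ (k ∸ 1) + tri (k ∸ 1)
tri-pred zero    = refl
tri-pred (suc k) = refl

pairCount : ∀ N → (Fin N → Bool) → ℕ
pairCount N b = ΣF N (λ u → ΣF N (λ v → Ind ((toℕ u <ᵇ toℕ v) ∧ b u ∧ b v)))

pairCount-suc : ∀ N (b : Fin (suc N) → Bool) →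
                pairCount (suc N) b ≡ count N (λ v → b zero ∧ b (suc v)) + pairCount N (b ∘ suc)
pairCount-suc N b = refl

pairCount-all : ∀ N {b : Fin N → Bool} → (∀ i → b i ≡ true) → pairCount N b ≡ tri N
pairCount-all zero    _   = refl
pairCount-all (suc N) {b} all = begin
  pairCount (suc N) b                                        ≡⟨ pairCount-suc N b ⟩
  count N (λ v → b zero ∧ b (suc v)) + pairCount N (b ∘ suc) ≡⟨ cong₂ _+_ row (pairCount-all N (all ∘ suc)) ⟩
  N + tri N                                                  ∎
  where
  open ≡-Reasoning
  row : count N (λ v → b zero ∧ b (suc v)) ≡ N
  row = count-all N (λ v → cong₂ _∧_ (all zero) (all (suc v)))

pairCount-oneFalse : ∀ N {b : Fin (suc N) → Bool} → b zero ≡ false → (∀ i → b (suc i) ≡ true) →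
                     pairCount (suc N) b ≡ tri N
pairCount-oneFalse N {b} b₀ rest = begin
  pairCount (suc N) b                                        ≡⟨ pairCount-suc N b ⟩
  count N (λ v → b zero ∧ b (suc v)) + pairCount N (b ∘ suc) ≡⟨ cong₂ _+_ row (pairCount-all N rest) ⟩
  0 + tri N                                                  ∎
  where
  open ≡-Reasoning
  row : count N (λ v → b zero ∧ b (suc v)) ≡ 0
  row = count-none N (λ v → cong (_∧ b (suc v)) b₀)

pairCount-amo : ∀ N {b : Fin N → Bool} → AtMostOneFalse b → tri (N ∸ 1) ≤ pairCount N b
pairCount-amo zero    _ = z≤n
pairCount-amo (suc N) {b} amo = by-head (b zero) refl
  where
  by-head : ∀ c → b zero ≡ c → tri N ≤ pairCount (suc N) b
  by-head false b₀ = ≤-reflexive (sym (pairCount-oneFalse N {b} b₀ (amo-head-false amo b₀)))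
  by-head true  b₀ = begin
    tri N                                                      ≡⟨ tri-pred N ⟩
    (N ∸ 1) + tri (N ∸ 1)                                      ≤⟨ +-mono-≤ (count-amo N (amo-tail amo)) (pairCount-amo N (amo-tail amo)) ⟩
    count N (b ∘ suc) + pairCount N (b ∘ suc)                  ≡⟨ cong (_+ pairCount N (b ∘ suc)) row ⟨
    count N (λ v → b zero ∧ b (suc v)) + pairCount N (b ∘ suc) ≡⟨ pairCount-suc N b ⟨
    pairCount (suc N) b                                        ∎
    where
    open ≤-Reasoning
    row : count N (λ v → b zero ∧ b (suc v)) ≡ count N (b ∘ suc)
    row = ΣF-cong N (λ v → cong (λ c → Ind (c ∧ b (suc v))) b₀)

-- Weak IASIs of complete graphs: the lower bound

IsComplete : Graph → Set
IsComplete G = ∀ u v → u ≢ v → adj G u v ≡ true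

complete-edge : ∀ {G} → IsComplete G → ∀ {u v} → toℕ u < toℕ v → Edge G u v
complete-edge complete {u} {v} u<v = u<v , complete u v (λ u≡v → <-irrefl (cong toℕ u≡v) u<v)

isMono : ∀ {G} → WeakIASI G → Fin (order G) → Bool
isMono w v = length (f w v) ≡ᵇ 1

nonempty-length : ∀ {A : List ℕ} → A ≢ [] → 1 ≤ length A
nonempty-length {[]}    A≢[] = contradiction refl A≢[]
nonempty-length {_ ∷ _} _    = s≤s z≤n

multi-indexed : ∀ {A : List ℕ} → A ≢ [] → (length A ≡ᵇ 1) ≡ false → 2 ≤ length A
multi-indexed {[]}        A≢[] _ = contradiction refl A≢[]
multi-indexed {_ ∷ []}    _    ()
multi-indexed {_ ∷ _ ∷ _} _    _ = s≤s (s≤s z≤n)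

edge-has-mono-end : ∀ {G} (w : WeakIASI G) {u v} → Edge G u v →
                    isMono w u ≡ true ⊎ isMono w v ≡ true
edge-has-mono-end w {u} {v} uv with isMono w u in mono-u | isMono w v in mono-v
... | true  | _    = inj₁ refl
... | false | true = inj₂ refl
... | false | false = contradiction (sym (weak w u v uv))
  (<⇒≢ (sumset-exceeds-max (unique w u) (unique w v)
          (multi-indexed (nonempty w u) mono-u) (multi-indexed (nonempty w v) mono-v)))

complete-amo : ∀ {G} → IsComplete G → (w : WeakIASI G) → AtMostOneFalse (isMono w)
complete-amo {G} complete w u v u≢v with <-cmp (toℕ u) (toℕ v)
... | tri< u<v _ _ = edge-has-mono-end w (complete-edge {G} complete u<v)
... | tri≈ _ u≡v _ = contradiction (Fin.toℕ-injective u≡v) u≢v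
... | tri> _ _ v<u = Data.Sum.swap (edge-has-mono-end w (complete-edge {G} complete v<u))

⊔≡ᵇ1 : ∀ {a b} → 1 ≤ a → 1 ≤ b → (a ⊔ b ≡ᵇ 1) ≡ (a ≡ᵇ 1) ∧ (b ≡ᵇ 1)
⊔≡ᵇ1 {1}           {1}           _ _ = refl
⊔≡ᵇ1 {1}           {suc (suc _)} _ _ = refl
⊔≡ᵇ1 {suc (suc _)} {1}           _ _ = refl
⊔≡ᵇ1 {suc (suc _)} {suc (suc _)} _ _ = refl

-- In a complete graph an edge u < v is mono-indexed iff both ends are, since a
-- weak IASI has |f u ⊕ f v| = max(|f u|, |f v|) and labels are non-empty.
mono-edge : ∀ {G} → IsComplete G → (w : WeakIASI G) → ∀ u v →
            (isEdge G u v ∧ (length (f w u ⊕ f w v) ≡ᵇ 1)) ≡ (toℕ u <ᵇ toℕ v) ∧ isMono w u ∧ isMono w v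
mono-edge {G} complete w u v with toℕ u <ᵇ toℕ v in u<ᵇv
... | false = refl
... | true  = begin
  adj G u v ∧ (length (f w u ⊕ f w v) ≡ᵇ 1)     ≡⟨ cong₂ _∧_ (proj₂ uv) (cong (_≡ᵇ 1) (weak w u v uv)) ⟩
  true ∧ (length (f w u) ⊔ length (f w v) ≡ᵇ 1) ≡⟨ ⊔≡ᵇ1 (nonempty-length (nonempty w u)) (nonempty-length (nonempty w v)) ⟩
  isMono w u ∧ isMono w v                        ∎
  where
  open ≡-Reasoning
  uv : Edge G u v
  uv = complete-edge {G} complete (<ᵇ⇒< (toℕ u) (toℕ v) (Equivalence.from T-≡ u<ᵇv))

monoCount-complete : ∀ {G} → IsComplete G → (w : WeakIASI G) → monoCount G w ≡ pairCount (order G) (isMono w)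
monoCount-complete {G} complete w =
  trans (sum-allFin (order G) _)
        (ΣF-cong (order G) λ u → trans (sum-allFin (order G) _)
                                       (ΣF-cong (order G) λ v → cong Ind (mono-edge complete w u v)))

complete-lower : ∀ {G} → IsComplete G → (w : WeakIASI G) → tri (order G ∸ 1) ≤ monoCount G w
complete-lower {G} complete w =
  subst (tri (order G ∸ 1) ≤_) (sym (monoCount-complete complete w))
        (pairCount-amo (order G) (complete-amo complete w))

2^-< : ∀ {i j} → i < j → 2 ^ i < 2 ^ j
2^-< = ^-monoʳ-< 2 (n<1+n 1)

2^-injective : ∀ {i j} → 2 ^ i ≡ 2 ^ j → i ≡ j
2^-injective {i} {j} 2^i≡2^j with <-cmp i j
... | tri< i<j _ _ = contradiction 2^i≡2^j (<⇒≢ (2^-< i<j))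
... | tri≈ _ i≡j _ = i≡j
... | tri> _ _ j<i = contradiction 2^i≡2^j (>⇒≢ (2^-< j<i))

larger-power-dominates : ∀ {i j k l} → i < j → j < l → 2 ^ i + 2 ^ j < 2 ^ k + 2 ^ l
larger-power-dominates {i} {j} {k} {l} i<j j<l = begin-strict
  2 ^ i + 2 ^ j         <⟨ +-monoˡ-< (2 ^ j) (2^-< i<j) ⟩
  2 ^ j + 2 ^ j         ≡⟨ cong (2 ^ j +_) (+-identityʳ (2 ^ j)) ⟨
  2 ^ suc j             ≤⟨ ^-monoʳ-≤ 2 j<l ⟩
  2 ^ l                 ≤⟨ m≤n+m (2 ^ l) (2 ^ k) ⟩
  2 ^ k + 2 ^ l         ∎
  where open ≤-Reasoning

2^-sidon : ∀ {i j k l} → i < j → k < l → 2 ^ i + 2 ^ j ≡ 2 ^ k + 2 ^ l → i ≡ k × j ≡ l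
2^-sidon {i} {j} {k} {l} i<j k<l sums≡ with <-cmp j l
... | tri< j<l _ _ = contradiction sums≡ (<⇒≢ (larger-power-dominates {i} {j} {k} {l} i<j j<l))
... | tri> _ _ l<j = contradiction (sym sums≡) (<⇒≢ (larger-power-dominates {k} {l} {i} {j} k<l l<j))
... | tri≈ _ refl _ = 2^-injective (+-cancelʳ-≡ (2 ^ j) (2 ^ i) (2 ^ k) sums≡) , refl

-- The power labelling: the upper bound

label : ∀ {N} → Fin N → List ℕ
label zero    = 0 ∷ 1 ∷ []
label (suc i) = 2 ^ toℕ i ∷ []

label-unique : ∀ {N} (v : Fin N) → Unique (label v)
label-unique zero    = ((λ ()) ∷ []) ∷ [] ∷ []
label-unique (suc i) = [] ∷ []

label-zero-sum : ∀ c → (0 ∷ 1 ∷ []) ⊕ (c ∷ []) ≡ c ∷ suc c ∷ []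
label-zero-sum c = cong (c ∷_) (filter-accept (¬? ∘ (c ≟_)) (1+n≢n ∘ sym))

singleton-∈ : ∀ {x y : ℕ} → x ∈ y ∷ [] → x ≡ y
singleton-∈ (here x≡y) = x≡y

least-of-pair : ∀ {c x} → x ∈ c ∷ suc c ∷ [] → c ≤ x
least-of-pair (here refl)         = ≤-refl
least-of-pair (there (here refl)) = n≤1+n _

label-suc-injective : ∀ {N} {i j : Fin N} → 2 ^ toℕ i ≡ 2 ^ toℕ j → suc i ≡ suc j
label-suc-injective = cong suc ∘ Fin.toℕ-injective ∘ 2^-injective

label-inj : ∀ {N} (u v : Fin N) → label u ≋ label v → u ≡ v
label-inj zero    zero    _ = refl
label-inj u@zero    v@(suc _) same = contradiction (≋⇒length≡ (label-unique u) (label-unique v) same) λ ()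
label-inj u@(suc _) v@zero    same = contradiction (≋⇒length≡ (label-unique u) (label-unique v) same) λ ()
label-inj (suc i) (suc j) same = label-suc-injective (singleton-∈ (proj₁ (same _) (here refl)))

label-weak : ∀ {N} (u v : Fin N) → toℕ u < toℕ v →
             length (label u ⊕ label v) ≡ length (label u) ⊔ length (label v)
label-weak zero    (suc j) _ = cong length (label-zero-sum (2 ^ toℕ j))
label-weak (suc i) (suc j) _ = refl

label-sum-sizes : ∀ {N} (u v u′ v′ : Fin N) → toℕ u < toℕ v → toℕ u′ < toℕ v′ →
                  (label u ⊕ label v) ≋ (label u′ ⊕ label v′) →
                  length (label u) ⊔ length (label v) ≡ length (label u′) ⊔ length (label v′)
label-sum-sizes u v u′ v′ u<v u′<v′ same =
  trans (sym (label-weak u v u<v))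
        (trans (≋⇒length≡ (⊕-unique (label u) (label v)) (⊕-unique (label u′) (label v′)) same) (label-weak u′ v′ u′<v′))

-- The label sums of two pairs u < v and u′ < v′ agree only if the pairs do:
-- {2^j, 2^j + 1} is recovered from its least element, {2^i + 2^j} by the
-- Sidon property, and the two kinds differ in size.
label-edgeInj : ∀ {N} (u v u′ v′ : Fin N) → toℕ u < toℕ v → toℕ u′ < toℕ v′ →
                (label u ⊕ label v) ≋ (label u′ ⊕ label v′) → (u ≡ u′) × (v ≡ v′)
label-edgeInj zero    zero    _ _ () _ _
label-edgeInj (suc _) zero    _ _ () _ _
label-edgeInj _ _ zero    zero    _ () _
label-edgeInj _ _ (suc _) zero    _ () _
label-edgeInj zero (suc j) zero (suc j′) _ _ same =
  refl , label-suc-injective (≤-antisym (below (λ x → Data.Product.swap (same x))) (below same))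
  where
  below : ∀ {c c′} → ((0 ∷ 1 ∷ []) ⊕ (c ∷ [])) ≋ ((0 ∷ 1 ∷ []) ⊕ (c′ ∷ [])) → c′ ≤ c
  below {c} {c′} same′ rewrite label-zero-sum c | label-zero-sum c′ =
    least-of-pair (proj₁ (same′ c) (here refl))
label-edgeInj (suc i) (suc j) (suc i′) (suc j′) i<j i′<j′ same
  with i≡i′ , j≡j′ ← 2^-sidon (s<s⁻¹ i<j) (s<s⁻¹ i′<j′) (singleton-∈ (proj₁ (same _) (here refl)))
  = cong suc (Fin.toℕ-injective i≡i′) , cong suc (Fin.toℕ-injective j≡j′)
label-edgeInj u@zero v@(suc _) u′@(suc _) v′@(suc _) u<v u′<v′ same =
  contradiction (label-sum-sizes u v u′ v′ u<v u′<v′ same) λ ()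
label-edgeInj u@(suc _) v@(suc _) u′@zero v′@(suc _) u<v u′<v′ same =
  contradiction (label-sum-sizes u v u′ v′ u<v u′<v′ same) λ ()

powerIASI : (G : Graph) → WeakIASI G
powerIASI G = record
  { f        = label
  ; unique   = label-unique
  ; nonempty = λ { zero () ; (suc _) () }
  ; inj      = label-inj
  ; edgeInj  = λ u v u′ v′ uv u′v′ → label-edgeInj u v u′ v′ (proj₁ uv) (proj₁ u′v′)
  ; weak     = λ u v uv → label-weak u v (proj₁ uv)
  }

-- Only vertex 0 of the power labelling is not mono-indexed.
pairCount-label : ∀ N → pairCount N (λ v → length (label v) ≡ᵇ 1) ≡ tri (N ∸ 1)
pairCount-label zero    = refl
pairCount-label (suc N) = pairCount-oneFalse N {λ v → length (label v) ≡ᵇ 1} refl (λ _ → refl)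

complete-sparing : (G : Graph) → IsComplete G → IsSparingNumber G (tri (order G ∸ 1))
complete-sparing G complete =
  (powerIASI G , trans (monoCount-complete {G} complete (powerIASI G)) (pairCount-label (order G))) ,
  complete-lower {G} complete

-- The square of K_{n,n} is complete

square-complete : (G : Graph) →
  (∀ u v → T (adj G u v ∨ any (λ w → adj G u w ∧ adj G w v) (allFin (order G)))) →
  IsComplete (square G)
square-complete G near u v u≢v = cong₂ _∧_ distinct (Equivalence.to T-≡ (near u v))
  where
  distinct : u ≠ᵇ v ≡ true
  distinct with u Fin.≟ v
  ... | yes u≡v = contradiction u≡v u≢v
  ... | no  _   = refl

any-intro : ∀ {A : Set} (p : A → Bool) {xs x} → x ∈ xs → T (p x) → T (any p xs)
any-intro p x∈xs px = any⁺ p (Any.map (λ { refl → px }) x∈xs)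

bipartite-near : ∀ {N} (s : Fin N → Bool) {w₀ w₁} → s w₀ ≡ true → s w₁ ≡ false → ∀ u v →
  T ((s u xor s v) ∨ any (λ w → (s u xor s w) ∧ (s w xor s v)) (allFin N))
bipartite-near s {w₀} {w₁} s₀ s₁ u v with s u | s v
... | true  | false = _
... | false | true  = _
... | true  | true  = any-intro _ (∈-allFin w₁) (subst (λ b → T ((true xor b) ∧ (b xor true))) (sym s₁) _)
... | false | false = any-intro _ (∈-allFin w₀) (subst (λ b → T ((false xor b) ∧ (b xor false))) (sym s₀) _)

<ᵇ-irrefl : ∀ n → (n <ᵇ n) ≡ false
<ᵇ-irrefl zero    = refl
<ᵇ-irrefl (suc n) = <ᵇ-irrefl n

-- Vertex 0 lies in the first part and vertex n in the second.
square-K-complete : ∀ p → IsComplete (square (K (suc p)))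
square-K-complete p = square-complete (K (suc p)) (bipartite-near (side (suc p)) {zero} {fromℕ< n<n+n} refl second-side)
  where
  n<n+n : suc p < suc p + suc p
  n<n+n = m<m+n (suc p) {suc p} z<s
  second-side : side (suc p) (fromℕ< n<n+n) ≡ false
  second-side = trans (cong (_<ᵇ suc p) (Fin.toℕ-fromℕ< n<n+n)) (<ᵇ-irrefl (suc p))

-- Arithmetic: C(2n-1, 2) = (n-1)(2n-1)

tri-closed : ∀ k → 2 * tri k + k ≡ k * k
tri-closed zero    = refl
tri-closed (suc k) = begin
  2 * (k + tri k) + suc k        ≡⟨ regroup k (tri k) ⟩
  (2 * tri k + k) + (2 * k + 1)  ≡⟨ cong (_+ (2 * k + 1)) (tri-closed k) ⟩
  k * k + (2 * k + 1)            ≡⟨ square-suc k ⟩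
  suc k * suc k                  ∎
  where
  open ≡-Reasoning
  regroup : ∀ k t → 2 * (k + t) + suc k ≡ (2 * t + k) + (2 * k + 1)
  regroup = solve-∀
  square-suc : ∀ k → k * k + (2 * k + 1) ≡ suc k * suc k
  square-suc = solve-∀

tri-odd : ∀ p → tri (p + suc p) ≡ p * (2 * suc p ∸ 1)
tri-odd p = *-cancelˡ-≡ (tri m) (p * (2 * suc p ∸ 1)) 2
  (+-cancelʳ-≡ m (2 * tri m) (2 * (p * (2 * suc p ∸ 1)))
    (trans (tri-closed m) (square-odd p)))
  where
  m : ℕ
  m = p + suc p
  square-odd : ∀ p → (p + suc p) * (p + suc p) ≡ 2 * (p * (p + (suc p + 0))) + (p + suc p)
  square-odd = solve-∀

corollary2p4 : ∀ (n : ℕ) → 1 ≤ n →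
    IsSparingNumber (square (K n)) ((n ∸ 1) * (2 * n ∸ 1))
corollary2p4 (suc p) _ =
  subst (IsSparingNumber (square (K (suc p)))) (tri-odd p)
        (complete-sparing (square (K (suc p))) (square-K-complete p))
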